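{- The class of dominated dcpos is $\Gamma$-faithful: for any two dominated dcpos $D$ and $E$, if $\Gamma(D)\cong\Gamma(E)$ (as ordered sets) then $D\cong E$ (as ordered sets).
   Context: For a dcpo $D$, $\Gamma(D)$ denotes the complete lattice of Scott-closed subsets of $D$, ordered by inclusion. A subset of $D$ is irreducible if it is nonempty and whenever it is contained in a union $B\cup C$ of two Scott-closed sets it is contained in $B$ or in $C$; "closed irreducible" means Scott-closed and irreducible in the Scott topology. $\mathsf{Irr}(D)$ denotes the set of closed irreducible subsets of $D$ ordered by inclusion. For $A',A\in\mathsf{Irr}(D)$ write $A'\triangleleft A$ if there is $x\in A$ with $A'\subseteq{\downarrow}x$, and $\nabla A=\{A'\in\mathsf{Irr}(D)\mid A'\triangleleft A\}$. A dcpo $D$ is dominated if for every $A\in\mathsf{Irr}(D)$ the collection $\nabla A$ is Scott-closed in the poset $\mathsf{Irr}(D)$. A class $\mathbf{C}$ of posets is $\Gamma$-faithful if for all $P,Q\in\mathbf{C}$, $\Gamma(P)\cong\Gamma(Q)$ implies $P\cong Q$. -}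

module Defs where

open import Level using (Level; _⊔_; suc)
open import Data.Product using (Σ; ∃; _×_; _,_; proj₁; proj₂)
open import Data.Sum using (_⊎_)
open import Relation.Unary using (Pred; _∈_; _⊆_; _∪_)
open import Relation.Binary.Bundles using (Poset)
open import Relation.Binary.Structures using (IsPartialOrder; IsPreorder; IsEquivalence)
open import Axiom.ExcludedMiddle using (ExcludedMiddle)
open import Relation.Binary.Morphism.Structures using (IsOrderIsomorphism)

module _ {c ℓ₁ ℓ₂ : Level} (P : Poset c ℓ₁ ℓ₂) where
  open Poset P

  Directed : ∀ {s} → Pred Carrier s → Set (c ⊔ ℓ₂ ⊔ s)
  Directed S = (∃ λ x → x ∈ S)
             × (∀ {x y} → x ∈ S → y ∈ S → ∃ λ z → z ∈ S × x ≤ z × y ≤ z)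

  IsUpperBound : ∀ {s} → Pred Carrier s → Carrier → Set (c ⊔ ℓ₂ ⊔ s)
  IsUpperBound S u = ∀ {x} → x ∈ S → x ≤ u

  IsSup : ∀ {s} → Pred Carrier s → Carrier → Set (c ⊔ ℓ₂ ⊔ s)
  IsSup S u = IsUpperBound S u × (∀ v → IsUpperBound S v → u ≤ v)

  IsDcpo : (s : Level) → Set (c ⊔ ℓ₂ ⊔ suc s)
  IsDcpo s = (S : Pred Carrier s) → Directed S → ∃ λ u → IsSup S u

  IsLowerSet : ∀ {a} → Pred Carrier a → Set (c ⊔ ℓ₂ ⊔ a)
  IsLowerSet A = ∀ {x y} → y ≤ x → x ∈ A → y ∈ A

  IsScottClosed : (s : Level) → ∀ {a} → Pred Carrier a → Set (c ⊔ ℓ₂ ⊔ a ⊔ suc s)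
  IsScottClosed s A = IsLowerSet A
    × ((S : Pred Carrier s) → Directed S → S ⊆ A → ∀ u → IsSup S u → u ∈ A)

  ↓_ : Carrier → Pred Carrier ℓ₂
  ↓ x = λ y → y ≤ x

_≅ₚ_ : ∀ {c₁ ℓ₁ ℓ₂ c₂ ℓ₃ ℓ₄} → Poset c₁ ℓ₁ ℓ₂ → Poset c₂ ℓ₃ ℓ₄
     → Set (c₁ ⊔ ℓ₁ ⊔ ℓ₂ ⊔ c₂ ⊔ ℓ₃ ⊔ ℓ₄)
P ≅ₚ Q = ∃ λ (f : Poset.Carrier P → Poset.Carrier Q) →
  IsOrderIsomorphism (Poset._≈_ P) (Poset._≈_ Q) (Poset._≤_ P) (Poset._≤_ Q) f

module _ {c a q : Level} (X : Set c) (Q : Pred X a → Set q) where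

  private
    Car : Set (c ⊔ suc a ⊔ q)
    Car = Σ (Pred X a) Q

    _≤ₛ_ : Car → Car → Set (c ⊔ a)
    A ≤ₛ B = proj₁ A ⊆ proj₁ B

    _≈ₛ_ : Car → Car → Set (c ⊔ a)
    A ≈ₛ B = (A ≤ₛ B) × (B ≤ₛ A)

  SubsetPoset : Poset (c ⊔ suc a ⊔ q) (c ⊔ a) (c ⊔ a)
  SubsetPoset = record
    { Carrier = Car
    ; _≈_ = _≈ₛ_
    ; _≤_ = _≤ₛ_
    ; isPartialOrder = record
      { isPreorder = record
        { isEquivalence = record
          { refl = (λ z → z) , (λ z → z)
          ; sym = λ e → proj₂ e , proj₁ e
          ; trans = λ e f → (λ z → proj₁ f (proj₁ e z)) , (λ z → proj₂ e (proj₂ f z))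
          }
        ; reflexive = proj₁
        ; trans = λ e f z → f (e z)
        }
      ; antisym = _,_
      }
    }

module _ {ℓ : Level} (D : Poset ℓ ℓ ℓ) where
  open Poset D

  Γ : Poset (suc ℓ) ℓ ℓ
  Γ = SubsetPoset Carrier (IsScottClosed D ℓ {ℓ})

  IsIrreducible : Pred Carrier ℓ → Set (suc ℓ)
  IsIrreducible A = (∃ λ x → x ∈ A)
    × ((B C : Pred Carrier ℓ) → IsScottClosed D ℓ B → IsScottClosed D ℓ C
       → A ⊆ B ∪ C → (A ⊆ B) ⊎ (A ⊆ C))

  IsClosedIrreducible : Pred Carrier ℓ → Set (suc ℓ)
  IsClosedIrreducible A = IsScottClosed D ℓ A × IsIrreducible A

  Irr : Poset (suc ℓ) ℓ ℓ
  Irr = SubsetPoset Carrier IsClosedIrreducible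

  _◁_ : Poset.Carrier Irr → Poset.Carrier Irr → Set ℓ
  A' ◁ A = ∃ λ x → x ∈ proj₁ A × (proj₁ A' ⊆ (↓_) D x)

  ∇ : Poset.Carrier Irr → Pred (Poset.Carrier Irr) ℓ
  ∇ A = λ A' → A' ◁ A

  IsDominated : Set (suc (suc ℓ))
  IsDominated = (A : Poset.Carrier Irr) → IsScottClosed Irr (suc ℓ) (∇ A)

  IsDominatedDcpo : Set (suc (suc ℓ))
  IsDominatedDcpo = IsDcpo D ℓ × IsDominated

IsΓFaithful : ∀ {ℓ k} → (Poset ℓ ℓ ℓ → Set k) → Set (suc ℓ ⊔ k)
IsΓFaithful {ℓ} C = (P Q : Poset ℓ ℓ ℓ) → C P → C Q → Γ P ≅ₚ Γ Q → P ≅ₚ Q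

module Submission where

open import Defs
open import Level using (Level; _⊔_; suc; Lift; lift; lower)
open import Axiom.ExcludedMiddle using (ExcludedMiddle)
open import Axiom.DoubleNegationElimination using (em⇒dne)
open import Data.Product using (∃; _×_; _,_; proj₁; proj₂)
open import Data.Sum using (inj₁; inj₂; [_,_]′)
import Data.Sum as Sum
open import Data.Empty using (⊥; ⊥-elim)
open import Relation.Nullary using (¬_; yes; no)
open import Relation.Nullary.Decidable using (map′)
open import Relation.Unary using (Pred; _∈_; _⊆_; _∪_; _∩_)
open import Relation.Binary.Core using (_Preserves_⟶_)
open import Relation.Binary.Bundles using (Poset)
open import Relation.Binary.Morphism.Structures using (IsOrderIsomorphism)
import Relation.Binary.Reasoning.PartialOrder as PosetReasoning
import Relation.Binary.Reasoning.Setoid as SetoidReasoning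

-- In Γ(D) the principal ideals ↓x can be recognised order-theoretically:
-- they are the closed irreducible sets A that belong to every Scott-closed
-- family 𝒞 ⊆ Irr(D) whose join in Γ(D) contains A ("inaccessible" sets).
-- Principal ideals are inaccessible because x ↦ ↓x is Scott-continuous into
-- Irr(D), so {x | ↓x ∈ 𝒞} is a Scott-closed upper bound of 𝒞.  Conversely,
-- the join of ∇A always contains A, so if ∇A is Scott-closed (domination)
-- then A ∈ ∇A, i.e. A = ↓x.  Irreducibility is join-primeness in Γ(D), so
-- an isomorphism Γ(D) ≅ Γ(E) preserves Irr and inaccessibility; it therefore
-- sends ↓x to some ↓y, and x ↦ y is the isomorphism D ≅ E.  Excluded middle
-- enters through binary unions of Scott-closed sets and nonemptiness.

lowerExcludedMiddle : ∀ {ℓ} → ExcludedMiddle (suc ℓ) → ExcludedMiddle ℓ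
lowerExcludedMiddle em = map′ lower lift em

module _ {c ℓ₁ ℓ₂ : Level} (P : Poset c ℓ₁ ℓ₂) where
  open Poset P

  Cofinal : ∀ {s t} → Pred Carrier s → Pred Carrier t → Set (c ⊔ ℓ₂ ⊔ s ⊔ t)
  Cofinal S T = ∀ {x} → x ∈ S → ∃ λ y → y ∈ T × x ≤ y

  module _ {s t} {S : Pred Carrier s} {T : Pred Carrier t}
           (T⊆S : T ⊆ S) (cofinal : Cofinal S T) where

    cofinal-directed : Directed P S → Directed P T
    cofinal-directed ((x , x∈S) , updirected) =
      (proj₁ (cofinal x∈S) , proj₁ (proj₂ (cofinal x∈S))) , bound
      where
      bound : ∀ {y₁ y₂} → y₁ ∈ T → y₂ ∈ T → ∃ λ z → z ∈ T × y₁ ≤ z × y₂ ≤ z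
      bound y₁∈T y₂∈T =
        let (z , z∈S , y₁≤z , y₂≤z) = updirected (T⊆S y₁∈T) (T⊆S y₂∈T)
            (w , w∈T , z≤w) = cofinal z∈S
        in w , w∈T , trans y₁≤z z≤w , trans y₂≤z z≤w

    cofinal-isSup : ∀ {u} → IsSup P S u → IsSup P T u
    cofinal-isSup (upper , least) =
      (λ y∈T → upper (T⊆S y∈T)) ,
      λ v v-upper → least v λ x∈S →
        let (y , y∈T , x≤y) = cofinal x∈S in trans x≤y (v-upper y∈T)

module _ {c₁ ℓ₁ ℓ₂ c₂ ℓ₃ ℓ₄ : Level} {P : Poset c₁ ℓ₁ ℓ₂} {Q : Poset c₂ ℓ₃ ℓ₄}
         (f : Poset.Carrier P → Poset.Carrier Q) where
  private
    module P = Poset P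
    module Q = Poset Q

  -- The down-closure of f[S], lifted by t so that Scott-closedness in Q can
  -- be tested against it at a larger level than that of S.
  ↓image : ∀ {s} (t : Level) → Pred P.Carrier s → Pred Q.Carrier (c₁ ⊔ ℓ₄ ⊔ s ⊔ t)
  ↓image t S y = Lift t (∃ λ x → x ∈ S × y Q.≤ f x)

  PreservesDirectedSups : (s t : Level) → Set (c₁ ⊔ ℓ₂ ⊔ c₂ ⊔ ℓ₄ ⊔ suc s ⊔ t)
  PreservesDirectedSups s t = (S : Pred P.Carrier s) → Directed P S →
    ∀ {u} → IsSup P S u → IsSup Q (↓image t S) (f u)

  module _ (mono : f Preserves P._≤_ ⟶ Q._≤_) where

    ↓image-directed : ∀ {s} t {S : Pred P.Carrier s} → Directed P S → Directed Q (↓image t S)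
    ↓image-directed t ((x , x∈S) , updirected) = (f x , lift (x , x∈S , Q.refl)) , bound
      where
      bound : ∀ {y₁ y₂} → y₁ ∈ ↓image t _ → y₂ ∈ ↓image t _ →
              ∃ λ z → z ∈ ↓image t _ × y₁ Q.≤ z × y₂ Q.≤ z
      bound (lift (x₁ , x₁∈S , y₁≤fx₁)) (lift (x₂ , x₂∈S , y₂≤fx₂)) =
        let (z , z∈S , x₁≤z , x₂≤z) = updirected x₁∈S x₂∈S
        in f z , lift (z , z∈S , Q.refl) ,
           Q.trans y₁≤fx₁ (mono x₁≤z) , Q.trans y₂≤fx₂ (mono x₂≤z)

    preimage-isScottClosed : ∀ {s t a} → PreservesDirectedSups s t →
      {C : Pred Q.Carrier a} → IsScottClosed Q (c₁ ⊔ ℓ₄ ⊔ s ⊔ t) C →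
      IsScottClosed P s (λ x → f x ∈ C)
    preimage-isScottClosed {t = t} preserves (C-lower , C-sup) =
      (λ y≤x fx∈C → C-lower (mono y≤x) fx∈C) ,
      λ S S-directed S⊆ u u-sup →
        C-sup (↓image t S) (↓image-directed t S-directed)
              (λ { (lift (x , x∈S , y≤fx)) → C-lower y≤fx (S⊆ x∈S) })
              (f u) (preserves S S-directed u-sup)

  lowerAdjoint-preservesDirectedSups : (g : Q.Carrier → P.Carrier) →
    (∀ {x y} → f x Q.≤ y → x P.≤ g y) → (∀ {x y} → x P.≤ g y → f x Q.≤ y) →
    ∀ {s} t → PreservesDirectedSups s t
  lowerAdjoint-preservesDirectedSups g f≤⇒≤g ≤g⇒f≤ t S _ (upper , least) =
    (λ { (lift (x , x∈S , y≤fx)) → Q.trans y≤fx (≤g⇒f≤ (P.trans (upper x∈S) (f≤⇒≤g Q.refl))) }) ,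
    λ v v-upper → ≤g⇒f≤ (least (g v) λ x∈S → f≤⇒≤g (v-upper (lift (_ , x∈S , Q.refl))))

record OrderEquivalence {c₁ ℓ₁ ℓ₂ c₂ ℓ₃ ℓ₄ : Level} (P : Poset c₁ ℓ₁ ℓ₂) (Q : Poset c₂ ℓ₃ ℓ₄)
       : Set (c₁ ⊔ ℓ₁ ⊔ ℓ₂ ⊔ c₂ ⊔ ℓ₃ ⊔ ℓ₄) where
  private
    module P = Poset P
    module Q = Poset Q
  field
    to        : P.Carrier → Q.Carrier
    from      : Q.Carrier → P.Carrier
    to-mono   : to Preserves P._≤_ ⟶ Q._≤_
    from-mono : from Preserves Q._≤_ ⟶ P._≤_
    to-from   : ∀ y → to (from y) Q.≈ y
    from-to   : ∀ x → from (to x) P.≈ x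

  to-cancel : ∀ {x x'} → to x Q.≤ to x' → x P.≤ x'
  to-cancel {x} {x'} le =
    P.trans (P.reflexive (P.Eq.sym (from-to x))) (P.trans (from-mono le) (P.reflexive (from-to x')))

  to-cong : ∀ {x x'} → x P.≈ x' → to x Q.≈ to x'
  to-cong eq = Q.antisym (to-mono (P.reflexive eq)) (to-mono (P.reflexive (P.Eq.sym eq)))

  to-≤⇒≤-from : ∀ {x y} → to x Q.≤ y → x P.≤ from y
  to-≤⇒≤-from {x} le = P.trans (P.reflexive (P.Eq.sym (from-to x))) (from-mono le)

  ≤-from⇒to-≤ : ∀ {x y} → x P.≤ from y → to x Q.≤ y
  ≤-from⇒to-≤ {y = y} le = Q.trans (to-mono le) (Q.reflexive (to-from y))

  from-≤⇒≤-to : ∀ {x y} → from y P.≤ x → y Q.≤ to x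
  from-≤⇒≤-to {y = y} le = Q.trans (Q.reflexive (Q.Eq.sym (to-from y))) (to-mono le)

OrderEquivalence-sym : ∀ {c₁ ℓ₁ ℓ₂ c₂ ℓ₃ ℓ₄} {P : Poset c₁ ℓ₁ ℓ₂} {Q : Poset c₂ ℓ₃ ℓ₄} →
  OrderEquivalence P Q → OrderEquivalence Q P
OrderEquivalence-sym e = record
  { to = from ; from = to ; to-mono = from-mono ; from-mono = to-mono
  ; to-from = from-to ; from-to = to-from }
  where open OrderEquivalence e

≅ₚ⇒OrderEquivalence : ∀ {c₁ ℓ₁ ℓ₂ c₂ ℓ₃ ℓ₄} {P : Poset c₁ ℓ₁ ℓ₂} {Q : Poset c₂ ℓ₃ ℓ₄} →
  P ≅ₚ Q → OrderEquivalence P Q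
≅ₚ⇒OrderEquivalence {P = P} {Q = Q} (f , f-iso) = record
  { to = f ; from = g ; to-mono = mono ; from-mono = g-mono
  ; to-from = f-g ; from-to = λ x → injective (f-g (f x)) }
  where
  open IsOrderIsomorphism f-iso
  module P = Poset P
  module Q = Poset Q
  g : Q.Carrier → P.Carrier
  g y = proj₁ (surjective y)
  f-g : ∀ y → f (g y) Q.≈ y
  f-g y = proj₂ (surjective y) P.Eq.refl
  g-mono : g Preserves Q._≤_ ⟶ P._≤_
  g-mono {y} {y'} le =
    cancel (Q.trans (Q.reflexive (f-g y)) (Q.trans le (Q.reflexive (Q.Eq.sym (f-g y')))))

module _ {ℓ : Level} (D : Poset ℓ ℓ ℓ) where
  open Poset D

  ↓-mono : ∀ {x y} → x ≤ y → ↓_ D x ⊆ ↓_ D y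
  ↓-mono x≤y z≤x = trans z≤x x≤y

  ↓-cancel : ∀ {x y} → ↓_ D x ⊆ ↓_ D y → x ≤ y
  ↓-cancel ↓x⊆↓y = ↓x⊆↓y refl

  lowerSet-↓⊆ : ∀ {a} {A : Pred Carrier a} → IsLowerSet D A → ∀ {x} → x ∈ A → ↓_ D x ⊆ A
  lowerSet-↓⊆ A-lower x∈A y≤x = A-lower y≤x x∈A

  ↓-isScottClosed : ∀ x → IsScottClosed D ℓ (↓_ D x)
  ↓-isScottClosed x = (λ y≤z z≤x → trans y≤z z≤x) , λ _ _ S⊆↓x _ (_ , least) → least x S⊆↓x

  ↓-isIrreducible : ∀ x → IsIrreducible D (↓_ D x)
  ↓-isIrreducible x = (x , refl) , λ B C (B-lower , _) (C-lower , _) ↓x⊆B∪C →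
    Sum.map (lowerSet-↓⊆ B-lower) (lowerSet-↓⊆ C-lower)
      (↓x⊆B∪C refl)

  ↓Γ : Carrier → Poset.Carrier (Γ D)
  ↓Γ x = ↓_ D x , ↓-isScottClosed x

  ↓Irr : Carrier → Poset.Carrier (Irr D)
  ↓Irr x = ↓_ D x , ↓-isScottClosed x , ↓-isIrreducible x

  ↓-injective : ∀ {x y} → Poset._≈_ (Γ D) (↓Γ x) (↓Γ y) → x ≈ y
  ↓-injective (↓x⊆↓y , ↓y⊆↓x) = antisym (↓-cancel ↓x⊆↓y) (↓-cancel ↓y⊆↓x)

  toΓ : Poset.Carrier (Irr D) → Poset.Carrier (Γ D)
  toΓ (A , A-closed , _) = A , A-closed

  ∅Γ : Poset.Carrier (Γ D)
  ∅Γ = (λ _ → Lift ℓ ⊥) , (λ _ ()) , λ _ ((_ , x∈S) , _) S⊆∅ _ _ → S⊆∅ x∈S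

  ∪-isScottClosed : ExcludedMiddle ℓ → ∀ {B C : Pred Carrier ℓ} →
    IsScottClosed D ℓ B → IsScottClosed D ℓ C → IsScottClosed D ℓ (B ∪ C)
  ∪-isScottClosed em {B} {C} (B-lower , B-sup) (C-lower , C-sup) = lower-set , sup
    where
    lower-set : IsLowerSet D (B ∪ C)
    lower-set y≤x = Sum.map (B-lower y≤x) (C-lower y≤x)

    -- Either S has a tail {y ∈ S | x ≤ y} missing B, and that tail lies in C,
    -- or S ∩ B is cofinal in S; in both cases u is the sup of a cofinal part.
    sup : ∀ S → Directed D S → S ⊆ B ∪ C → ∀ u → IsSup D S u → u ∈ B ∪ C
    sup S S-directed@(_ , updirected) S⊆B∪C u u-sup
      with em {∃ λ x → x ∈ S × (∀ {y} → y ∈ S → x ≤ y → ¬ B y)}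
    ... | yes (x , x∈S , tail∉B) =
      inj₂ (C-sup T (cofinal-directed D proj₁ cofinal S-directed) T⊆C u
                  (cofinal-isSup D proj₁ cofinal u-sup))
      where
      T : Pred Carrier ℓ
      T = S ∩ (x ≤_)
      cofinal : Cofinal D S T
      cofinal y∈S = let (z , z∈S , y≤z , x≤z) = updirected y∈S x∈S in z , (z∈S , x≤z) , y≤z
      T⊆C : T ⊆ C
      T⊆C (y∈S , x≤y) =
        [ (λ y∈B → ⊥-elim (tail∉B y∈S x≤y y∈B)) , (λ y∈C → y∈C) ]′ (S⊆B∪C y∈S)
    ... | no no-tail =
      inj₁ (B-sup (S ∩ B) (cofinal-directed D proj₁ cofinal S-directed) proj₂ u
                  (cofinal-isSup D proj₁ cofinal u-sup))
      where
      cofinal : Cofinal D S (S ∩ B)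
      cofinal {x} x∈S = em⇒dne em λ ¬above →
        no-tail (x , x∈S , λ y∈S x≤y y∈B → ¬above (_ , (y∈S , y∈B) , x≤y))

  ∪Γ : ExcludedMiddle ℓ → Poset.Carrier (Γ D) → Poset.Carrier (Γ D) → Poset.Carrier (Γ D)
  ∪Γ em (B , B-closed) (C , C-closed) = B ∪ C , ∪-isScottClosed em B-closed C-closed

  ↓Irr-preservesDirectedSups : PreservesDirectedSups {P = D} {Q = Irr D} ↓Irr ℓ (suc ℓ)
  ↓Irr-preservesDirectedSups S S-directed {u} (upper , least) =
    (λ { (lift (x , x∈S , B⊆↓x)) y∈B → trans (B⊆↓x y∈B) (upper x∈S) }) ,
    λ { (V , (V-lower , V-sup) , _) V-upper y≤u →
          let S⊆V = λ {x} x∈S → V-upper {↓Irr x} (lift (x , x∈S , λ z → z)) refl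
          in V-lower y≤u (V-sup S S-directed S⊆V u (upper , least)) }

  -- The join of 𝒞 in Γ(D) is the Scott closure of ⋃ 𝒞.
  _⊑⋁_ : Poset.Carrier (Irr D) → Pred (Poset.Carrier (Irr D)) ℓ → Set (suc ℓ)
  A ⊑⋁ 𝒞 = (U : Poset.Carrier (Γ D)) → (∀ {B} → B ∈ 𝒞 → proj₁ B ⊆ proj₁ U) → proj₁ A ⊆ proj₁ U

  IsInaccessible : Poset.Carrier (Irr D) → Set (suc (suc ℓ))
  IsInaccessible A = (𝒞 : Pred (Poset.Carrier (Irr D)) ℓ) →
    IsScottClosed (Irr D) (suc ℓ) 𝒞 → A ⊑⋁ 𝒞 → A ∈ 𝒞

  principal⇒inaccessible : ∀ A → _◁_ D A A → IsInaccessible A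
  principal⇒inaccessible A (x , x∈A , A⊆↓x) 𝒞 𝒞-closed@(𝒞-lower , _) A⊑⋁𝒞 =
    𝒞-lower {↓Irr x} {A} A⊆↓x (A⊑⋁𝒞 V V-upper x∈A)
    where
    V : Poset.Carrier (Γ D)
    V = (λ y → ↓Irr y ∈ 𝒞) ,
        preimage-isScottClosed {P = D} {Q = Irr D} ↓Irr ↓-mono ↓Irr-preservesDirectedSups 𝒞-closed
    V-upper : ∀ {B} → B ∈ 𝒞 → proj₁ B ⊆ proj₁ V
    V-upper {B@(_ , (B-lower , _) , _)} B∈𝒞 y∈B =
      𝒞-lower {B} {↓Irr _} (lowerSet-↓⊆ B-lower y∈B) B∈𝒞

  inaccessible⇒principal : IsDominated D → ∀ A → IsInaccessible A → _◁_ D A A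
  inaccessible⇒principal D-dominated A A-inaccessible =
    A-inaccessible (∇ D A) (D-dominated A) λ U ∇A≤U {y} y∈A →
      ∇A≤U {↓Irr y} (y , y∈A , λ z → z) refl

module Transfer {ℓ : Level} (em : ExcludedMiddle ℓ) {D E : Poset ℓ ℓ ℓ}
                (e : OrderEquivalence (Γ D) (Γ E)) where
  open OrderEquivalence e

  to-isIrreducible : ∀ {A} (A-closed : IsScottClosed D ℓ A) → IsIrreducible D A →
    IsIrreducible E (proj₁ (to (A , A-closed)))
  to-isIrreducible {A} A-closed ((x , x∈A) , A-prime) = nonempty , prime
    where
    A′ : Poset.Carrier (Γ D)
    A′ = A , A-closed

    nonempty : ∃ λ y → y ∈ proj₁ (to A′)
    nonempty = em⇒dne em λ empty →
      lower (to-cancel {A′} {∅Γ D} (λ y∈toA → ⊥-elim (empty (_ , y∈toA))) x∈A)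

    -- A ⊆ from B ∪ from C, because to (from B ∪ from C) contains B ∪ C ⊇ to A.
    prime : (B C : Pred (Poset.Carrier E) ℓ) → IsScottClosed E ℓ B → IsScottClosed E ℓ C →
      proj₁ (to A′) ⊆ B ∪ C → (proj₁ (to A′) ⊆ B) Sum.⊎ (proj₁ (to A′) ⊆ C)
    prime B C B-closed C-closed toA⊆B∪C =
      Sum.map (≤-from⇒to-≤ {A′} {B′}) (≤-from⇒to-≤ {A′} {C′})
        (A-prime _ _ (proj₂ (from B′)) (proj₂ (from C′)) (to-cancel {A′} {W} toA⊆toW))
      where
      B′ C′ : Poset.Carrier (Γ E)
      B′ = B , B-closed
      C′ = C , C-closed
      W : Poset.Carrier (Γ D)
      W = ∪Γ D em (from B′) (from C′)
      toA⊆toW : proj₁ (to A′) ⊆ proj₁ (to W)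
      toA⊆toW y∈toA =
        [ from-≤⇒≤-to {W} {B′} inj₁ , from-≤⇒≤-to {W} {C′} inj₂ ]′ (toA⊆B∪C y∈toA)

  toIrr : Poset.Carrier (Irr D) → Poset.Carrier (Irr E)
  toIrr (A , A-closed , A-irreducible) =
    proj₁ (to (A , A-closed)) , proj₂ (to (A , A-closed)) , to-isIrreducible A-closed A-irreducible

module _ {ℓ : Level} (em : ExcludedMiddle ℓ) {D E : Poset ℓ ℓ ℓ}
         (e : OrderEquivalence (Γ D) (Γ E)) where
  open OrderEquivalence e
  open Transfer em {D} {E} e using (toIrr)
  open Transfer em {E} {D} (OrderEquivalence-sym e) using () renaming (toIrr to fromIrr)

  toIrr-isInaccessible : ∀ A → IsInaccessible D A → IsInaccessible E (toIrr A)
  toIrr-isInaccessible A A-inaccessible 𝒞 𝒞-closed@(𝒞-lower , _) toA⊑⋁𝒞 =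
    A-inaccessible (λ B → toIrr B ∈ 𝒞)
      (preimage-isScottClosed {P = Irr D} {Q = Irr E} toIrr
        (λ {B} {B′} → to-mono {toΓ D B} {toΓ D B′})
        (lowerAdjoint-preservesDirectedSups {P = Irr D} {Q = Irr E} toIrr fromIrr
          (λ {B} {B′} → to-≤⇒≤-from {toΓ D B} {toΓ E B′})
          (λ {B} {B′} → ≤-from⇒to-≤ {toΓ D B} {toΓ E B′}) (suc ℓ))
        𝒞-closed)
      A⊑⋁
    where
    A⊑⋁ : _⊑⋁_ D A (λ B → toIrr B ∈ 𝒞)
    A⊑⋁ U bounds = to-cancel {toΓ D A} {U} (toA⊑⋁𝒞 (to U) bounds′)
      where
      bounds′ : ∀ {B′} → B′ ∈ 𝒞 → proj₁ B′ ⊆ proj₁ (to U)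
      bounds′ {B′} B′∈𝒞 = from-≤⇒≤-to {U} {toΓ E B′}
        (bounds {fromIrr B′} (𝒞-lower {B′} {toIrr (fromIrr B′)} (proj₁ (to-from (toΓ E B′))) B′∈𝒞))

  -- Opaque: unfolding this proof during later conversion checks is prohibitively expensive.
  opaque
    to-↓≈↓ : IsDominated E → ∀ x → ∃ λ y → Poset._≈_ (Γ E) (to (↓Γ D x)) (↓Γ E y)
    to-↓≈↓ E-dominated x =
      let (y , y∈to↓x , to↓x⊆↓y) = inaccessible⇒principal E E-dominated (toIrr (↓Irr D x))
            (toIrr-isInaccessible (↓Irr D x)
              (principal⇒inaccessible D (↓Irr D x) (x , Poset.refl D , λ y≤x → y≤x)))
      in y , to↓x⊆↓y , lowerSet-↓⊆ E (proj₁ (proj₂ (to (↓Γ D x)))) y∈to↓x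

module Points {ℓ : Level} (em : ExcludedMiddle ℓ) {D E : Poset ℓ ℓ ℓ}
              (e : OrderEquivalence (Γ D) (Γ E)) (E-dominated : IsDominated E) where
  open OrderEquivalence e
  private
    module D = Poset D
    module E = Poset E
    module ΓE = Poset (Γ E)

  point : D.Carrier → E.Carrier
  point x = proj₁ (to-↓≈↓ em {D} {E} e E-dominated x)

  to-↓-point : ∀ x → to (↓Γ D x) ΓE.≈ ↓Γ E (point x)
  to-↓-point x = proj₂ (to-↓≈↓ em {D} {E} e E-dominated x)

  point-mono : point Preserves D._≤_ ⟶ E._≤_
  point-mono {x} {x′} x≤x′ = ↓-cancel E (begin
    ↓Γ E (point x)  ≈⟨ to-↓-point x ⟨
    to (↓Γ D x)     ≤⟨ to-mono (↓-mono D x≤x′) ⟩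
    to (↓Γ D x′)    ≈⟨ to-↓-point x′ ⟩
    ↓Γ E (point x′) ∎)
    where open PosetReasoning (Γ E)

  point-cancel : ∀ {x x′} → point x E.≤ point x′ → x D.≤ x′
  point-cancel {x} {x′} px≤px′ = ↓-cancel D (to-cancel (begin
    to (↓Γ D x)     ≈⟨ to-↓-point x ⟩
    ↓Γ E (point x)  ≤⟨ ↓-mono E px≤px′ ⟩
    ↓Γ E (point x′) ≈⟨ to-↓-point x′ ⟨
    to (↓Γ D x′)    ∎))
    where open PosetReasoning (Γ E)

  point-cong : ∀ {x x′} → x D.≈ x′ → point x E.≈ point x′
  point-cong eq = E.antisym (point-mono (D.reflexive eq)) (point-mono (D.reflexive (D.Eq.sym eq)))

  point-injective : ∀ {x x′} → point x E.≈ point x′ → x D.≈ x′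
  point-injective eq = D.antisym (point-cancel (E.reflexive eq)) (point-cancel (E.reflexive (E.Eq.sym eq)))

module _ {ℓ : Level} (em : ExcludedMiddle ℓ) {D E : Poset ℓ ℓ ℓ}
         (e : OrderEquivalence (Γ D) (Γ E))
         (D-dominated : IsDominated D) (E-dominated : IsDominated E) where
  open OrderEquivalence e
  open Points em {D} {E} e E-dominated
  open Points em {E} {D} (OrderEquivalence-sym e) D-dominated using ()
    renaming (point to copoint; to-↓-point to from-↓-copoint)
  private
    module D = Poset D
    module E = Poset E

  point-surjective : ∀ y → ∃ λ x → ∀ {x′} → x′ D.≈ x → point x′ E.≈ y
  point-surjective y =
    copoint y , λ x′≈x → E.Eq.trans (point-cong x′≈x) (↓-injective E ↓point≈↓y)
    where
    open SetoidReasoning (Poset.Eq.setoid (Γ E))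
    ↓point≈↓y : Poset._≈_ (Γ E) (↓Γ E (point (copoint y))) (↓Γ E y)
    ↓point≈↓y = begin
      ↓Γ E (point (copoint y)) ≈⟨ to-↓-point (copoint y) ⟨
      to (↓Γ D (copoint y))    ≈⟨ to-cong (from-↓-copoint y) ⟨
      to (from (↓Γ E y))       ≈⟨ to-from (↓Γ E y) ⟩
      ↓Γ E y                   ∎

  point-isOrderIsomorphism : IsOrderIsomorphism D._≈_ E._≈_ D._≤_ E._≤_ point
  point-isOrderIsomorphism = record
    { isOrderMonomorphism = record
      { isOrderHomomorphism = record { cong = point-cong ; mono = point-mono }
      ; injective = point-injective
      ; cancel = point-cancel
      }
    ; surjective = point-surjective
    }

theorem2p14 : {ℓ : Level} → ExcludedMiddle (suc ℓ) → IsΓFaithful (IsDominatedDcpo {ℓ})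
theorem2p14 em D E (_ , D-dominated) (_ , E-dominated) Γ≅ =
  Points.point em′ {D} {E} e E-dominated , point-isOrderIsomorphism em′ {D} {E} e D-dominated E-dominated
  where
  em′ : ExcludedMiddle _
  em′ = lowerExcludedMiddle em
  e : OrderEquivalence (Γ D) (Γ E)
  e = ≅ₚ⇒OrderEquivalence Γ≅
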